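{- Let $k>1$ be an integer, let ${\tt w}_{\rm TM}$ be the Thue--Morse word, and let ${\tt w}=\phi_k({\tt w}_{\rm TM})$. Identify ${\tt a}=k$ and ${\tt b}=-k$. Then ${\tt w}$ is the only word ${\tt v}=\ell_0\ell_1\cdots\in\mathcal{W}$ starting with ${\tt a}=k$ such that ${\tt v}=r_{\tt v}(1)r_{\tt v}(2)\cdots r_{\tt v}(n)\cdots$, i.e. $\ell_{n-1}=r_{\tt v}(n)$ for all $n\geqslant1$.
   Context: Words are infinite one-sided words over $\{{\tt a},{\tt b}\}$ indexed from position $0$; $\mathcal{W}$ is the set of such words in which both letters occur infinitely often. $p_{\tt a}(n)$, $p_{\tt b}(n)$ are the positions of the $n$-th ${\tt a}$ and $n$-th ${\tt b}$, and $r_{\tt v}(n)=p_{\tt b}(n)-p_{\tt a}(n)$. The Thue--Morse word ${\tt w}_{\rm TM}$ is the fixed point starting with ${\tt a}$ of ${\tt a}\mapsto{\tt a}{\tt b},\ {\tt b}\mapsto{\tt b}{\tt a}$. The cloning substitution $\phi_k$ maps ${\tt a}\mapsto{\tt a}^k$, ${\tt b}\mapsto{\tt b}^k$. -}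

module Defs where

open import Data.Nat using (ℕ; zero; suc; _+_; _≤_; _/_; _^_)
open import Data.List using (List; []; _∷_; _++_; concatMap)
open import Data.Product using (Σ; _×_; ∃)
open import Data.Integer using (ℤ; +_; -_; _-_)
open import Relation.Binary.PropositionalEquality using (_≡_)

data Letter : Set where
  a b : Letter

Word : Set
Word = ℕ → Letter

InfOften : Letter → Word → Set
InfOften c v = ∀ m → ∃ λ n → m ≤ n × v n ≡ c

InW : Word → Set
InW v = InfOften a v × InfOften b v

count : Letter → Word → ℕ → ℕ
count c v zero = 0
count c v (suc p) with v p | c
... | a | a = suc (count c v p)
... | b | b = suc (count c v p)
... | a | b = count c v p
... | b | a = count c v p

-- IsPos c v n p : p is the position of the (n+1)-th occurrence of c in v,
-- i.e. p_c(n+1) = p  (occurrences are counted from 1, as in the paper).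
IsPos : Letter → Word → ℕ → ℕ → Set
IsPos c v n p = v p ≡ c × count c v p ≡ n

μ : List Letter → List Letter
μ = concatMap (λ { a → a ∷ b ∷ [] ; b → b ∷ a ∷ [] })

iterate : ℕ → List Letter → List Letter
iterate zero xs = xs
iterate (suc m) xs = μ (iterate m xs)

at : List Letter → ℕ → Letter
at [] _ = a
at (x ∷ xs) zero = x
at (x ∷ xs) (suc n) = at xs n

-- Thue–Morse word: fixed point of μ starting with a.
-- μ^(n+1)(a) has length 2^(n+1) > n and is a prefix of the fixed point.
wTM : Word
wTM n = at (iterate (suc n) (a ∷ [])) n

-- Cloning substitution φ_k (a ↦ a^k, b ↦ b^k) applied to an infinite word.
φ : (k : ℕ) → .{{_ : Data.Nat.NonZero k}} → Word → Word
φ k x n = x (n / k)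

val : ℕ → Letter → ℤ
val k a = + k
val k b = - (+ k)

-- ℓ_{n-1} = r_v(n) for all n ≥ 1 (written with n = m+1), where
-- r_v(n) = p_b(n) - p_a(n).
SelfDescribing : ℕ → Word → Set
SelfDescribing k v = ∀ m p q → IsPos a v m p → IsPos b v m q →
  val k (v m) ≡ (+ q) - (+ p)

{-# OPTIONS --safe #-}
-- Write c̄ for the letter other than c. For c = v n, self-description says that the (n+1)-th c̄
-- lies exactly k after the (n+1)-th c. If both letters occur n times among the first N letters,
-- both of these occurrences lie at or after N, so no c̄ occurs in [N, N + k): the block at N
-- starts with c^k. If moreover v n, …, v (n+k-1) all equal c, the (n+1)-th to (n+k)-th c sit at
-- N, …, N+k-1, so the matching c̄'s fill [N + k, N + 2k), and both letters occur n + k times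
-- among the first N + 2k letters. With N = 2jk and n = jk, the letters v n, …, v (n+k-1) lie
-- in the part already determined (or, for j = 0, are forced by v 0 = a), so v is determined
-- block by block. The cloned Thue–Morse word has exactly these blocks, since w_TM(2j) = w_TM(j)
-- and w_TM(2j+1) = w̄_TM(j), and the same bookkeeping shows that it is self-describing.
module Submission where

open import Defs
open import Data.Nat using (ℕ; zero; suc; _+_; _*_; _∸_; _≤_; _<_; _≤′_; ≤′-reflexive; ≤′-step; z≤n; s≤s; z<s; s≤s⁻¹; NonZero; >-nonZero⁻¹; _/_; _%_)
open import Data.Nat.Properties
open import Data.Nat.DivMod using (+-distrib-/-∣ˡ; m*n/n≡m; m<n⇒m/n≡0; m≡m%n+[m/n]*n; m%n<n; 0/n≡0)
open import Data.Nat.Divisibility using (n∣m*n)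
open import Algebra.Properties.CommutativeSemigroup +-commutativeSemigroup using (xy∙z≈xz∙y)
open import Data.Integer as ℤ using (+_; -_)
import Data.Integer.Properties as ℤ
open import Algebra.Properties.AbelianGroup ℤ.+-0-abelianGroup using (//-rightDividesˡ; ⁻¹-anti-homo‿-)
open import Data.List using (List; []; _∷_; _++_; length)
open import Data.List.Properties using (++-assoc; ++-identityʳ; concatMap-++)
open import Data.Product using (_×_; _,_; ∃; proj₁; proj₂)
open import Data.Sum using (_⊎_; inj₁; inj₂)
open import Relation.Nullary using (yes; no; contradiction)
open import Relation.Binary.PropositionalEquality
open import Function.Base using (_∘′_)

private variable
  c d : Letter
  v u : Word
  i j k m n p q x N : ℕ

other : Letter → Letter
other a = b
other b = a

other≢ : ∀ c → other c ≢ c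
other≢ a ()
other≢ b ()

letter-dichotomy : ∀ l c → l ≡ c ⊎ l ≡ other c
letter-dichotomy a a = inj₁ refl
letter-dichotomy a b = inj₂ refl
letter-dichotomy b a = inj₂ refl
letter-dichotomy b b = inj₁ refl

≢other⇒≡ : ∀ {l} → l ≢ other c → l ≡ c
≢other⇒≡ {c} {l} l≢c̄ with letter-dichotomy l c
... | inj₁ l≡c = l≡c
... | inj₂ l≡c̄ = contradiction l≡c̄ l≢c̄

≡other⇒≢ : ∀ {l} → l ≡ other c → l ≢ c
≡other⇒≢ {c} l≡c̄ l≡c = other≢ c (trans (sym l≡c̄) l≡c)

InW⇒InfOften : InW v → ∀ c → InfOften c v
InW⇒InfOften (a-often , _) a = a-often
InW⇒InfOften (_ , b-often) b = b-often

-- Occurrences of a letter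

count-hit : ∀ v x → v x ≡ c → count c v (suc x) ≡ suc (count c v x)
count-hit {a} v x vx≡c rewrite vx≡c = refl
count-hit {b} v x vx≡c rewrite vx≡c = refl

count-miss : ∀ v x → v x ≢ c → count c v (suc x) ≡ count c v x
count-miss {c} v x vx≢c with letter-dichotomy (v x) c
... | inj₁ vx≡c = contradiction vx≡c vx≢c
... | inj₂ vx≡c̄ with c
...   | a rewrite vx≡c̄ = refl
...   | b rewrite vx≡c̄ = refl

count-step : ∀ c v x → count c v x ≤ count c v (suc x)
count-step c v x with letter-dichotomy (v x) c
... | inj₁ vx≡c = ≤-trans (n≤1+n _) (≤-reflexive (sym (count-hit v x vx≡c)))
... | inj₂ vx≡c̄ = ≤-reflexive (sym (count-miss v x (≡other⇒≢ vx≡c̄)))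

count-mono : x ≤ N → count c v x ≤ count c v N
count-mono {c = c} {v = v} = go ∘′ ≤⇒≤′
  where
  go : x ≤′ N → count c v x ≤ count c v N
  go (≤′-reflexive refl) = ≤-refl
  go (≤′-step x≤′N) = ≤-trans (go x≤′N) (count-step c v _)

count-hit-< : v x ≡ c → x < N → count c v x < count c v N
count-hit-< {v} {x} vx≡c x<N =
  ≤-trans (≤-reflexive (sym (count-hit v x vx≡c))) (count-mono x<N)

count-cong : (∀ x → x < N → v x ≡ u x) → count c v N ≡ count c u N
count-cong {zero} _ = refl
count-cong {suc N} {v} {u} {c} agree with letter-dichotomy (u N) c
... | inj₁ uN≡c = begin
  count c v (suc N)  ≡⟨ count-hit v N (trans (agree N ≤-refl) uN≡c) ⟩
  suc (count c v N)  ≡⟨ cong suc (count-cong (λ x x<N → agree x (m<n⇒m<1+n x<N))) ⟩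
  suc (count c u N)  ≡⟨ count-hit u N uN≡c ⟨
  count c u (suc N)  ∎
  where open ≡-Reasoning
... | inj₂ uN≡c̄ = begin
  count c v (suc N)  ≡⟨ count-miss v N (≡other⇒≢ (trans (agree N ≤-refl) uN≡c̄)) ⟩
  count c v N        ≡⟨ count-cong (λ x x<N → agree x (m<n⇒m<1+n x<N)) ⟩
  count c u N        ≡⟨ count-miss u N (≡other⇒≢ uN≡c̄) ⟨
  count c u (suc N)  ∎
  where open ≡-Reasoning

IsPos⇒≤ : count c v N ≡ n → IsPos c v n p → N ≤ p
IsPos⇒≤ countN≡n (vp≡c , countp≡n) = ≮⇒≥ λ p<N →
  <-irrefl refl (subst₂ _<_ countp≡n countN≡n (count-hit-< vp≡c p<N))

IsPos-unique : ∀ p q → IsPos c v n p → IsPos c v n q → p ≡ q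
IsPos-unique _ _ P Q = ≤-antisym (IsPos⇒≤ (proj₂ P) Q) (IsPos⇒≤ (proj₂ Q) P)

IsPos-gap : count c v N ≡ n → IsPos c v n q → N ≤ x → x < q → v x ≢ c
IsPos-gap {c} {v} {N} {x = x} countN≡n (_ , countq≡n) N≤x x<q vx≡c =
  <⇒≱ (subst (count c v x <_) countq≡n (count-hit-< vx≡c x<q))
      (subst (_≤ count c v x) countN≡n (count-mono N≤x))

count>⇒IsPos : ∀ M → n < count c v M → ∃ (IsPos c v n)
count>⇒IsPos zero ()
count>⇒IsPos {n} {c} {v} (suc M) n<count with n <? count c v M | letter-dichotomy (v M) c
... | yes n<count′ | _ = count>⇒IsPos M n<count′
... | no n≮count′ | inj₁ vM≡c =
  M , vM≡c ,
  ≤-antisym (≮⇒≥ n≮count′) (s≤s⁻¹ (subst (n <_) (count-hit v M vM≡c) n<count))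
... | no n≮count′ | inj₂ vM≡c̄ =
  contradiction (subst (n <_) (count-miss v M (≡other⇒≢ vM≡c̄)) n<count) n≮count′

InfOften⇒count-unbounded : InfOften c v → ∀ n → ∃ λ M → n < count c v M
InfOften⇒count-unbounded {c} {v} often zero with often 0
... | x , _ , vx≡c = suc x , subst (0 <_) (sym (count-hit v x vx≡c)) z<s
InfOften⇒count-unbounded {c} {v} often (suc n) with InfOften⇒count-unbounded often n
... | M , n<countM with often M
...   | x , M≤x , vx≡c =
  suc x ,
  subst (suc n <_) (sym (count-hit v x vx≡c)) (s≤s (<-≤-trans n<countM (count-mono M≤x)))

count-unbounded⇒InfOften : (∀ n → ∃ λ M → n < count c v M) → InfOften c v
count-unbounded⇒InfOften {c} {v} unbounded m with unbounded (count c v m)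
... | M , countm<countM with count>⇒IsPos M countm<countM
...   | p , P = p , IsPos⇒≤ refl P , proj₁ P

IsPos-exists : InfOften c v → ∀ n → ∃ (IsPos c v n)
IsPos-exists often n =
  let M , n<countM = InfOften⇒count-unbounded often n in count>⇒IsPos M n<countM

-- Runs and balanced prefixes

record Run (v : Word) (c : Letter) (N m : ℕ) : Set where
  constructor mkRun
  field letter-at : ∀ i → i < m → v (N + i) ≡ c
open Run

Run-prefix : Run v c N m → i ≤ m → Run v c N i
Run-prefix run i≤m = mkRun λ j j<i → letter-at run j (<-≤-trans j<i i≤m)

count-run : Run v c N m → count c v (N + m) ≡ count c v N + m
count-run {v} {c} {N} {zero} _ = trans (cong (count c v) (+-identityʳ N)) (sym (+-identityʳ _))
count-run {v} {c} {N} {suc m} run = begin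
  count c v (N + suc m)    ≡⟨ cong (count c v) (+-suc N m) ⟩
  count c v (suc (N + m))  ≡⟨ count-hit v (N + m) (letter-at run m ≤-refl) ⟩
  suc (count c v (N + m))  ≡⟨ cong suc (count-run (Run-prefix run (n≤1+n m))) ⟩
  suc (count c v N + m)    ≡⟨ +-suc _ m ⟨
  count c v N + suc m      ∎
  where open ≡-Reasoning

count-run-≢ : Run v c N m → d ≢ c → count d v (N + m) ≡ count d v N
count-run-≢ {v} {N = N} {zero} {d} _ _ = cong (count d v) (+-identityʳ N)
count-run-≢ {v} {N = N} {suc m} {d} run d≢c = begin
  count d v (N + suc m)    ≡⟨ cong (count d v) (+-suc N m) ⟩
  count d v (suc (N + m))  ≡⟨ count-miss v (N + m) v[N+m]≢d ⟩
  count d v (N + m)        ≡⟨ count-run-≢ (Run-prefix run (n≤1+n m)) d≢c ⟩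
  count d v N              ∎
  where
  open ≡-Reasoning
  v[N+m]≢d : v (N + m) ≢ d
  v[N+m]≢d v≡d = d≢c (trans (sym v≡d) (letter-at run m ≤-refl))

run-IsPos : Run v c N m → count c v N ≡ n → i < m → IsPos c v (n + i) (N + i)
run-IsPos {i = i} run countN≡n i<m =
  letter-at run i i<m , trans (count-run (Run-prefix run (<⇒≤ i<m))) (cong (_+ i) countN≡n)

Balanced : Word → ℕ → ℕ → Set
Balanced v N n = ∀ c → count c v N ≡ n

Balanced-block : Balanced v N n → Run v c N k → Run v (other c) (N + k) k →
                 Balanced v (N + k + k) (n + k)
Balanced-block {v} {N} {n} {c} {k} balanced run run′ d with letter-dichotomy d c
... | inj₁ refl = begin
  count d v (N + k + k)  ≡⟨ count-run-≢ run′ (≢-sym (other≢ d)) ⟩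
  count d v (N + k)      ≡⟨ count-run run ⟩
  count d v N + k        ≡⟨ cong (_+ k) (balanced d) ⟩
  n + k                  ∎
  where open ≡-Reasoning
... | inj₂ refl = begin
  count d v (N + k + k)  ≡⟨ count-run run′ ⟩
  count d v (N + k) + k  ≡⟨ cong (_+ k) (count-run-≢ run (other≢ c)) ⟩
  count d v N + k        ≡⟨ cong (_+ k) (balanced d) ⟩
  n + k                  ∎
  where open ≡-Reasoning

AgreeBelow : ℕ → Word → Word → Set
AgreeBelow N v u = ∀ x → x < N → v x ≡ u x

AgreeBelow-extend : AgreeBelow N v u → Run v c N m → Run u c N m → AgreeBelow (N + m) v u
AgreeBelow-extend {N} {v} {u} {m = m} agree runᵥ runᵤ x x<N+m with x <? N
... | yes x<N = agree x x<N
... | no x≮N = subst (λ y → v y ≡ u y) (m+[n∸m]≡n N≤x)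
  (trans (letter-at runᵥ _ i<m) (sym (letter-at runᵤ _ i<m)))
  where
  N≤x : N ≤ x
  N≤x = ≮⇒≥ x≮N
  i<m : x ∸ N < m
  i<m = subst (x ∸ N <_) (m+n∸m≡n N _) (∸-monoˡ-< x<N+m N≤x)

-- Self-describing words

+[m+n]-+m≡+n : ∀ m n → + (m + n) ℤ.- + m ≡ + n
+[m+n]-+m≡+n m n = begin
  + (m + n) ℤ.- + m  ≡⟨ ℤ.[+m]-[+n]≡m⊖n (m + n) m ⟩
  (m + n) ℤ.⊖ m      ≡⟨ ℤ.⊖-≥ (m≤m+n m n) ⟩
  + (m + n ∸ m)      ≡⟨ cong +_ (m+n∸m≡n m n) ⟩
  + n                ∎
  where open ≡-Reasoning

+n≡+o-+m⇒o≡m+n : ∀ {m n o} → + n ≡ + o ℤ.- + m → o ≡ m + n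
+n≡+o-+m⇒o≡m+n {m} {n} {o} +n≡+o-+m = ℤ.+-injective (begin
    + o                  ≡⟨ //-rightDividesˡ (+ m) (+ o) ⟨
    + o ℤ.- + m ℤ.+ + m  ≡⟨ cong (ℤ._+ + m) +n≡+o-+m ⟨
    + n ℤ.+ + m          ≡⟨ ℤ.+-comm (+ n) (+ m) ⟩
    + m ℤ.+ + n          ≡⟨ ℤ.pos-+ m n ⟨
    + (m + n)            ∎)
  where open ≡-Reasoning

-- The self-description ℓ_m = r_v(m+1) without integers: for c = v m, the (m+1)-th c̄ lies k
-- after the (m+1)-th c.
Describes : ℕ → Word → Set
Describes k v = ∀ {m c} → v m ≡ c → ∃ λ p → IsPos c v m p × IsPos (other c) v m (p + k)

describes⇒selfDescribing : Describes k v → SelfDescribing k v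
describes⇒selfDescribing {k} {v} describes m p q P Q with v m in vm≡
... | a = let r , R , R′ = describes vm≡ in
  subst₂ (λ p q → + k ≡ + q ℤ.- + p) (IsPos-unique r p R P) (IsPos-unique (r + k) q R′ Q)
    (sym (+[m+n]-+m≡+n r k))
... | b = let r , R , R′ = describes vm≡ in
  subst₂ (λ p q → - + k ≡ + q ℤ.- + p) (IsPos-unique (r + k) p R′ P) (IsPos-unique r q R Q)
    (trans (cong -_ (sym (+[m+n]-+m≡+n r k))) (⁻¹-anti-homo‿- (+ (r + k)) (+ r)))

selfDescribing⇒shift : SelfDescribing k v → v m ≡ c →
                       IsPos c v m p → IsPos (other c) v m q → q ≡ p + k
selfDescribing⇒shift {k} {c = a} selfDescribing vm≡a P Q =
  +n≡+o-+m⇒o≡m+n (trans (cong (val k) (sym vm≡a)) (selfDescribing _ _ _ P Q))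
selfDescribing⇒shift {k} {v} {m} {b} {p} {q} selfDescribing vm≡b P Q =
  +n≡+o-+m⇒o≡m+n (begin
    + k              ≡⟨ ℤ.neg-involutive (+ k) ⟨
    - - + k          ≡⟨ cong (-_ ∘′ val k) vm≡b ⟨
    - val k (v m)    ≡⟨ cong -_ (selfDescribing _ _ _ Q P) ⟩
    - (+ p ℤ.- + q)  ≡⟨ ⁻¹-anti-homo‿- (+ p) (+ q) ⟩
    + q ℤ.- + p      ∎)
  where open ≡-Reasoning

selfDescribing⇒describes : InW v → SelfDescribing k v → Describes k v
selfDescribing⇒describes {v} inW selfDescribing {m} {c} vm≡c
  with IsPos-exists (InW⇒InfOften inW c) m | IsPos-exists (InW⇒InfOften inW (other c)) m
... | p , P | q , Q =
  p , P , subst (IsPos (other c) v m) (selfDescribing⇒shift selfDescribing vm≡c P Q) Q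

describes⇒run : Describes k v → Balanced v N n → v n ≡ c → Run v c N k
describes⇒run {k} {v} {N} {n} {c} describes balanced vn≡c with describes vn≡c
... | p , P , Q = mkRun λ i i<k → ≢other⇒≡ (IsPos-gap (balanced (other c)) Q (m≤m+n N i)
  (<-≤-trans (+-monoʳ-< N i<k) (+-monoˡ-≤ k (IsPos⇒≤ (balanced c) P))))

describes⇒run-other : Describes k v → Balanced v N n → Run v c N k → Run v c n k →
                      Run v (other c) (N + k) k
describes⇒run-other {k} {v} {N} {n} {c} describes balanced run runₙ = mkRun λ i i<k →
  let p , P , Q = describes (letter-at runₙ i i<k)
      p≡N+i = IsPos-unique p (N + i) P (run-IsPos run (balanced c) i<k)
  in subst (λ y → v y ≡ other c) (trans (cong (_+ k) p≡N+i) (xy∙z≈xz∙y N i k))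
       (proj₁ Q)

-- The Thue–Morse word

tm : ℕ → List Letter
tm m = iterate m (a ∷ [])

length-μ : ∀ xs → length (μ xs) ≡ length xs + length xs
length-μ [] = refl
length-μ (a ∷ xs) = cong suc (trans (cong suc (length-μ xs)) (sym (+-suc _ _)))
length-μ (b ∷ xs) = cong suc (trans (cong suc (length-μ xs)) (sym (+-suc _ _)))

at-μ-even : ∀ xs j → at (μ xs) (j + j) ≡ at xs j
at-μ-even [] j = refl
at-μ-even (a ∷ xs) zero = refl
at-μ-even (b ∷ xs) zero = refl
at-μ-even (a ∷ xs) (suc j) rewrite +-suc j j = at-μ-even xs j
at-μ-even (b ∷ xs) (suc j) rewrite +-suc j j = at-μ-even xs j

at-μ-odd : ∀ xs j → j < length xs → at (μ xs) (suc (j + j)) ≡ other (at xs j)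
at-μ-odd (a ∷ xs) zero _ = refl
at-μ-odd (b ∷ xs) zero _ = refl
at-μ-odd (a ∷ xs) (suc j) (s≤s j<n) rewrite +-suc j j = at-μ-odd xs j j<n
at-μ-odd (b ∷ xs) (suc j) (s≤s j<n) rewrite +-suc j j = at-μ-odd xs j j<n

at-++ˡ : ∀ xs ys {n} → n < length xs → at (xs ++ ys) n ≡ at xs n
at-++ˡ (x ∷ xs) ys {zero} _ = refl
at-++ˡ (x ∷ xs) ys {suc n} (s≤s n<m) = at-++ˡ xs ys n<m

tm-prefix-suc : ∀ m → ∃ λ zs → tm (suc m) ≡ tm m ++ zs
tm-prefix-suc zero = b ∷ [] , refl
tm-prefix-suc (suc m) with tm-prefix-suc m
... | zs , tm[1+m]≡ = μ zs , trans (cong μ tm[1+m]≡) (concatMap-++ _ (tm m) zs)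

tm-prefix : m ≤′ n → ∃ λ zs → tm n ≡ tm m ++ zs
tm-prefix {m} (≤′-reflexive refl) = [] , sym (++-identityʳ (tm m))
tm-prefix {m} {suc n} (≤′-step m≤′n) with tm-prefix m≤′n | tm-prefix-suc n
... | zs , tmn≡ | ys , tm[1+n]≡ =
  zs ++ ys , trans tm[1+n]≡ (trans (cong (_++ ys) tmn≡) (++-assoc (tm m) zs ys))

m<length-tm : ∀ m → m < length (tm m)
m<length-tm zero = s≤s z≤n
m<length-tm (suc m) = subst (suc m <_) (sym (length-μ (tm m)))
  (+-mono-≤ (<-≤-trans z<s (m<length-tm m)) (m<length-tm m))

j<length-tm[1+j] : ∀ j → j < length (tm (suc j))
j<length-tm[1+j] j = <-trans (n<1+n j) (m<length-tm (suc j))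

at-tm≡wTM : ∀ m → n < length (tm m) → at (tm m) n ≡ wTM n
at-tm≡wTM {n} m n<len with ≤-total m (suc n)
... | inj₁ m≤1+n = let zs , tm[1+n]≡ = tm-prefix (≤⇒≤′ m≤1+n) in
  sym (trans (cong (λ xs → at xs n) tm[1+n]≡) (at-++ˡ (tm m) zs n<len))
... | inj₂ 1+n≤m = let zs , tmm≡ = tm-prefix (≤⇒≤′ 1+n≤m) in
  trans (cong (λ xs → at xs n) tmm≡) (at-++ˡ (tm (suc n)) zs (j<length-tm[1+j] n))

j+j<length-μ : ∀ xs → j < length xs → j + j < length (μ xs)
j+j<length-μ xs j<len = subst (_ <_) (sym (length-μ xs)) (+-mono-< j<len j<len)

1+j+j<length-μ : ∀ xs → j < length xs → suc (j + j) < length (μ xs)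
1+j+j<length-μ {j} xs j<len =
  subst₂ _≤_ (cong suc (+-suc j j)) (sym (length-μ xs)) (+-mono-≤ j<len j<len)

wTM-even : ∀ j → wTM (j + j) ≡ wTM j
wTM-even j = begin
  wTM (j + j)                  ≡⟨ at-tm≡wTM (suc (suc j)) (j+j<length-μ (tm (suc j)) j<len) ⟨
  at (μ (tm (suc j))) (j + j)  ≡⟨ at-μ-even (tm (suc j)) j ⟩
  wTM j                        ∎
  where
  open ≡-Reasoning
  j<len = j<length-tm[1+j] j

wTM-odd : ∀ j → wTM (suc (j + j)) ≡ other (wTM j)
wTM-odd j = begin
  wTM (suc (j + j))                  ≡⟨ at-tm≡wTM (suc (suc j)) (1+j+j<length-μ (tm (suc j)) j<len) ⟨
  at (μ (tm (suc j))) (suc (j + j))  ≡⟨ at-μ-odd (tm (suc j)) j j<len ⟩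
  other (wTM j)                      ∎
  where
  open ≡-Reasoning
  j<len = j<length-tm[1+j] j

-- The cloned Thue–Morse word

[m*n+o]/n≡m : ∀ m {n o} .{{_ : NonZero n}} → o < n → (m * n + o) / n ≡ m
[m*n+o]/n≡m m {n} {o} o<n = begin
  (m * n + o) / n      ≡⟨ +-distrib-/-∣ˡ o (n∣m*n m) ⟩
  m * n / n + o / n    ≡⟨ cong₂ _+_ (m*n/n≡m m n) (m<n⇒m/n≡0 o<n) ⟩
  m + 0                ≡⟨ +-identityʳ m ⟩
  m                    ∎
  where open ≡-Reasoning

[1+j+1+j]*k : ∀ j k → (suc j + suc j) * k ≡ (j + j) * k + k + k
[1+j+1+j]*k j k = begin
  (suc j + suc j) * k    ≡⟨ cong (λ l → suc l * k) (+-suc j j) ⟩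
  k + (k + (j + j) * k)  ≡⟨ +-comm k _ ⟩
  k + (j + j) * k + k    ≡⟨ cong (_+ k) (+-comm k _) ⟩
  (j + j) * k + k + k    ∎
  where open ≡-Reasoning

module Cloned (k : ℕ) .{{_ : NonZero k}} where

  w : Word
  w = φ k wTM

  w-block : ∀ j → i < k → w (j * k + i) ≡ wTM j
  w-block j i<k = cong wTM ([m*n+o]/n≡m j i<k)

  w-run : ∀ j → Run w (wTM j) ((j + j) * k) k
  w-run j = mkRun λ i i<k → trans (w-block (j + j) i<k) (wTM-even j)

  w-run-other : ∀ j → Run w (other (wTM j)) ((j + j) * k + k) k
  w-run-other j = mkRun λ i i<k →
    trans (cong (λ y → w (y + i)) (+-comm _ k)) (trans (w-block (suc (j + j)) i<k) (wTM-odd j))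

  w-balanced : ∀ j → Balanced w ((j + j) * k) (j * k)
  w-balanced zero _ = refl
  w-balanced (suc j) = subst₂ (Balanced w) (sym ([1+j+1+j]*k j k)) (+-comm (j * k) k)
    (Balanced-block (w-balanced j) (w-run j) (w-run-other j))

  w-describes : Describes k w
  w-describes {m} {c} wm≡c =
    subst₂ (λ m c → ∃ λ p → IsPos c w m p × IsPos (other c) w m (p + k)) m≡ wm≡c
      ( (m/k + m/k) * k + m%k
      , run-IsPos (w-run m/k) (w-balanced m/k _) m%k<k
      , subst (IsPos _ w _) (xy∙z≈xz∙y _ k m%k) (run-IsPos (w-run-other m/k) count≡ m%k<k))
    where
    m/k = m / k
    m%k = m % k
    m%k<k = m%n<n m k
    m≡ : m/k * k + m%k ≡ m
    m≡ = trans (+-comm (m/k * k) m%k) (sym (m≡m%n+[m/n]*n m k))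
    count≡ : count (other (wTM m/k)) w ((m/k + m/k) * k + k) ≡ m/k * k
    count≡ = trans (count-run-≢ (w-run m/k) (other≢ _)) (w-balanced m/k _)

  w-InW : InW w
  w-InW = often a , often b
    where
    often : ∀ c → InfOften c w
    often c = count-unbounded⇒InfOften λ n → (suc n + suc n) * k ,
      subst (n <_) (sym (w-balanced (suc n) c)) (<-≤-trans (n<1+n n) (m≤m*n (suc n) k))

  w-starts-with-a : w 0 ≡ a
  w-starts-with-a = cong wTM (0/n≡0 k)

  module Unique (v : Word) (describes : Describes k v) (v0≡a : v 0 ≡ a) where

    lower-run : ∀ j → AgreeBelow ((j + j) * k) v w → Run v (wTM j) (j * k) k
    lower-run zero _ = describes⇒run describes (λ _ → refl) v0≡a
    lower-run (suc j) agree =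
      mkRun λ i i<k → trans (agree _ (lower<upper i<k)) (w-block (suc j) i<k)
      where
      lower<upper : ∀ {r} → r < k → suc j * k + r < (suc j + suc j) * k
      lower<upper {r} r<k = subst (suc j * k + r <_) (sym (*-distribʳ-+ k (suc j) (suc j)))
        (+-monoʳ-< (suc j * k) (<-≤-trans r<k (m≤m+n k (j * k))))

    agree-step : ∀ j → AgreeBelow ((j + j) * k) v w → AgreeBelow ((suc j + suc j) * k) v w
    agree-step j agree = subst (λ N → AgreeBelow N v w) (sym ([1+j+1+j]*k j k))
      (AgreeBelow-extend (AgreeBelow-extend agree run (w-run j)) run′ (w-run-other j))
      where
      balanced : Balanced v ((j + j) * k) (j * k)
      balanced c = trans (count-cong agree) (w-balanced j c)
      lower : Run v (wTM j) (j * k) k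
      lower = lower-run j agree
      run : Run v (wTM j) ((j + j) * k) k
      run = describes⇒run describes balanced
        (subst (λ x → v x ≡ wTM j) (+-identityʳ _) (letter-at lower 0 (>-nonZero⁻¹ k)))
      run′ : Run v (other (wTM j)) ((j + j) * k + k) k
      run′ = describes⇒run-other describes balanced run lower

    agrees : ∀ j → AgreeBelow ((j + j) * k) v w
    agrees zero _ ()
    agrees (suc j) = agree-step j (agrees j)

    v≡w : ∀ n → v n ≡ w n
    v≡w n = agrees (suc n) n
      (<-≤-trans (n<1+n n) (≤-trans (m≤m+n (suc n) (suc n)) (m≤m*n _ k)))

theorem6p5 : (k : ℕ) → .{{_ : NonZero k}} → 1 < k →
    (InW (φ k wTM) × φ k wTM 0 ≡ a × SelfDescribing k (φ k wTM))
    × ((v : Word) → InW v → v 0 ≡ a → SelfDescribing k v →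
        (n : ℕ) → v n ≡ φ k wTM n)
theorem6p5 k _ =
  (w-InW , w-starts-with-a , describes⇒selfDescribing w-describes) ,
  λ v inW v0≡a selfDescribing →
    Unique.v≡w v (selfDescribing⇒describes inW selfDescribing) v0≡a
  where open Cloned k
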